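{- For every triple of NOF permutation problems $I,J,K$, each over the alphabet $\{0,1\}^n$, we have $\mathrm{cc}(I\otimes J\otimes K)\le (1+o(1))n$, where $o(1)\to0$ as $n\to\infty$. In particular, for any NOF permutation problem $I$ over the alphabet $\{0,1\}^n$, $\mathrm{acc}(I)\le (1+o(1))\frac n3$.
   Context: A NOF permutation problem over alphabet $\Sigma$ is a set $I\subset\Sigma^3$ such that for any two coordinates there is exactly one value of the third coordinate giving a triple of $I$. It is viewed as a three-player promise problem over $\Gamma=\Sigma^2$ with promise $P_{NOF}=\{((i,j),(j,k),(k,i)) : i,j,k\in\Sigma\}$ (the support of the matrix multiplication tensor $\langle |\Sigma|,|\Sigma|,|\Sigma|\rangle$) and accepting set $\tilde I=\{((x,y),(y,z),(z,x)):(x,y,z)\in I\}$. For a promise problem $I'\subset P\subset A\times B\times C$ three players receive $a,b,c$ with $(a,b,c)\in P$ and must decide whether $(a,b,c)\in I'$; $\mathrm{cc}$ denotes deterministic communication complexity in the shared-blackboard model (players in cyclic order append bits depending on own input and the board, or accept/reject; input accepted iff all accept; correctness required only on $P$; cost = maximum number of bits written). The Kronecker product of promise problems $(I_1,P_1)$, $(I_2,P_2)$ is the promise problem with promise $\{((a_1,a_2),(b_1,b_2),(c_1,c_2)) : (a_i,b_i,c_i)\in P_i\}$ and accepting set $\{((a_1,a_2),(b_1,b_2),(c_1,c_2)) : (a_i,b_i,c_i)\in I_i\}$ (deciding whether both instances are accepting); $I\otimes J\otimes K$ denotes the Kronecker product of $(\tilde I,P_{NOF}),(\tilde J,P_{NOF}),(\tilde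 K,P_{NOF})$. $(I',P)^{\otimes m}$ is the $m$-fold Kronecker product, and the asymptotic communication complexity is $\mathrm{acc}(I',P)=\lim_{m\to\infty}\mathrm{cc}((I',P)^{\otimes m})/m$; $\mathrm{acc}(I)$ means $\mathrm{acc}(\tilde I,P_{NOF})$. -}

module Defs where

open import Data.Nat using (ℕ; zero; suc; _+_; _*_; _≤_)
open import Data.Bool using (Bool; true; false; _∧_; T)
open import Data.Vec using (Vec)
open import Data.Product using (Σ; _×_; _,_; proj₁; proj₂)
open import Data.Unit using (⊤; tt)
open import Relation.Binary.PropositionalEquality using (_≡_)
open import Function.Bundles using (_⇔_)

record PromiseProblem : Set₁ where
  field
    A B C   : Set
    promise : A → B → C → Set
    accept  : A → B → C → Set
open PromiseProblem public

-- Deterministic shared-blackboard protocols (as protocol trees).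
-- At an internal node one player writes a bit depending on her own
-- input (the board = the path taken so far).

data Protocol (A B C : Set) : Set where
  leaf    : (A → Bool) → (B → Bool) → (C → Bool) → Protocol A B C
  speakA  : (A → Bool) → Protocol A B C → Protocol A B C → Protocol A B C
  speakB  : (B → Bool) → Protocol A B C → Protocol A B C → Protocol A B C
  speakC  : (C → Bool) → Protocol A B C → Protocol A B C → Protocol A B C

run : ∀ {A B C} → Protocol A B C → A → B → C → Bool
run (leaf fa fb fc) a b c = fa a ∧ fb b ∧ fc c
run (speakA f p q) a b c with f a
... | false = run p a b c
... | true  = run q a b c
run (speakB f p q) a b c with f b
... | false = run p a b c
... | true  = run q a b c
run (speakC f p q) a b c with f c
... | false = run p a b c
... | true  = run q a b c

cost : ∀ {A B C} → Protocol A B C → ℕ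
cost (leaf _ _ _)   = 0
cost (speakA _ p q) = suc (cost p Data.Nat.⊔ cost q)
cost (speakB _ p q) = suc (cost p Data.Nat.⊔ cost q)
cost (speakC _ p q) = suc (cost p Data.Nat.⊔ cost q)

Solves : (Q : PromiseProblem) → Protocol (A Q) (B Q) (C Q) → Set
Solves Q p = ∀ a b c → promise Q a b c → (T (run p a b c) ⇔ accept Q a b c)

ccLE : PromiseProblem → ℕ → Set
ccLE Q k = Σ (Protocol (A Q) (B Q) (C Q)) λ p → Solves Q p × cost p ≤ k

_⊗_ : PromiseProblem → PromiseProblem → PromiseProblem
Q ⊗ R = record
  { A = A Q × A R ; B = B Q × B R ; C = C Q × C R
  ; promise = λ a b c → promise Q (proj₁ a) (proj₁ b) (proj₁ c)
                       × promise R (proj₂ a) (proj₂ b) (proj₂ c)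
  ; accept  = λ a b c → accept Q (proj₁ a) (proj₁ b) (proj₁ c)
                       × accept R (proj₂ a) (proj₂ b) (proj₂ c) }

trivialProblem : PromiseProblem
trivialProblem = record { A = ⊤ ; B = ⊤ ; C = ⊤
                        ; promise = λ _ _ _ → ⊤ ; accept = λ _ _ _ → ⊤ }

_⊗^_ : PromiseProblem → ℕ → PromiseProblem
Q ⊗^ zero  = trivialProblem
Q ⊗^ suc m = Q ⊗ (Q ⊗^ m)

ExactlyOne : {S : Set} → (S → Set) → Set
ExactlyOne {S} P = Σ S λ z → P z × (∀ z' → P z' → z' ≡ z)

IsNOFPermutation : {S : Set} → (S → S → S → Bool) → Set
IsNOFPermutation I =
    (∀ x y → ExactlyOne λ z → T (I x y z))
  × (∀ y z → ExactlyOne λ x → T (I x y z))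
  × (∀ x z → ExactlyOne λ y → T (I x y z))

NOFProblem : {S : Set} → (S → S → S → Bool) → PromiseProblem
NOFProblem {S} I = record
  { A = S × S ; B = S × S ; C = S × S
  ; promise = λ a b c → PNOF a b c
  ; accept  = λ a b c → PNOF a b c × T (I (proj₁ a) (proj₁ b) (proj₁ c)) }
  where
  PNOF : S × S → S × S → S × S → Set
  PNOF a b c = (proj₂ a ≡ proj₁ b) × (proj₂ b ≡ proj₁ c) × (proj₂ c ≡ proj₁ a)

Alphabet : ℕ → Set
Alphabet n = Vec Bool n

triple : {S : Set} → (I J K : S → S → S → Bool) → PromiseProblem
triple I J K = (NOFProblem I ⊗ NOFProblem J) ⊗ NOFProblem K

-- Alice sees i₁, j₁, Bob sees j₂, k₂ and Carol sees i₃, k₃, so Alice knows the unique k₁* with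
-- I(i₁, j₁, k₁*), Bob the unique i₂* with J(i₂*, j₂, k₂) and Carol the unique j₃* with
-- K(i₃, j₃*, k₃); the input is accepted iff k₁* = k₁, i₂* = i₂ and j₃* = j₃. Alice announces
-- code(k₁*, i₂, j₃), and Bob and Carol compare it with code(k₁, i₂*, j₃) and code(k₁, i₂, j₃*),
-- which they can compute. This is correct as soon as two such coincidences force all three
-- equalities ("corner-injectivity"). Cutting a word of {0,1}ⁿ into blocks of s bits gives a
-- vector of numbers below 2ˢ, and (a + b + c, ‖a - b‖²) is corner-injective by the parallelogram
-- law: if p + y = x + q then ‖p - y‖² + ‖x - q‖² = 2‖x - y‖² + 2‖p - x‖², so equal distances
-- force p = x. Written in binary this code has about (1 + 3/s) n + 2s bits.
-- For the asymptotic bound, m copies are grouped into ⌊m/3⌋ triples solved this way, plus at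
-- most two copies solved by announcing k₁*.

{-# OPTIONS --safe #-}
module Submission where

open import Defs
open import Data.Nat using (ℕ; suc; _*_; _≤_)
open import Data.Bool using (Bool)
open import Data.Product using (Σ; _×_)

open import Algebra.Bundles using (CommutativeMonoid)
open import Data.Bool using (true; false; T; _∧_)
import Data.Bool as Bool
open import Data.Bool.Properties using (T-∧; ∧-commutativeMonoid)
open import Data.Integer as ℤ using (+_; -[1+_])
import Data.Integer.Properties as ℤ
import Data.Integer.Tactic.RingSolver as ℤ-Solver
open import Data.Nat
open import Data.Nat.Divisibility using (n∣m*n)
open import Data.Nat.DivMod
  using ( _%_; _/_; m≡m%n+[m/n]*n; m%n<n; [m+kn]%n≡m%n; m<n⇒m%n≡m; m<n*o⇒m/o<n; +-distrib-/-∣ʳ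
        ; m<n⇒m/n≡0; m*n/n≡m; m/n*n≤m)
open import Data.Nat.Properties
open import Data.Nat.Tactic.RingSolver using (solve-∀)
open import Data.Product using (_,_; proj₁; proj₂; map₂)
open import Data.Product.Function.NonDependent.Propositional using (_×-⇔_)
open import Data.Sum using (inj₁; inj₂)
open import Data.Unit using (tt)
open import Data.Vec using (Vec; []; _∷_; _++_; head; tail; zipWith; sum)
open import Data.Vec.Properties using (∷-injective; ++-injectiveˡ; ++-injectiveʳ; ≡-dec)
open import Data.Vec.Relation.Unary.All using (All; []; _∷_)
open import Function using (_∘_)
open import Function.Bundles using (_⇔_; mk⇔; Equivalence)
open import Function.Definitions using (Injective)
import Function.Properties.Equivalence as ⇔
open import Relation.Binary.PropositionalEquality
open import Relation.Nullary.Decidable using (⌊_⌋; toWitness; fromWitness)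
open import Algebra.Properties.CommutativeSemigroup
  (CommutativeMonoid.commutativeSemigroup ∧-commutativeMonoid)
  using () renaming (interchange to ∧-interchange)
open import Algebra.Properties.CommutativeSemigroup +-commutativeSemigroup
  using () renaming (interchange to +-interchange)

-- Positional notation

fromDigits : ∀ B {k} → Vec ℕ k → ℕ
fromDigits B []       = 0
fromDigits B (d ∷ ds) = d + fromDigits B ds * B

digits : ∀ B .{{_ : NonZero B}} k → ℕ → Vec ℕ k
digits B zero    N = []
digits B (suc k) N = N % B ∷ digits B k (N / B)

digits-< : ∀ B .{{_ : NonZero B}} k N → All (_< B) (digits B k N)
digits-< B zero    N = []
digits-< B (suc k) N = m%n<n N B ∷ digits-< B k (N / B)

fromDigits-digits : ∀ B .{{_ : NonZero B}} k {N} → N < B ^ k → fromDigits B (digits B k N) ≡ N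
fromDigits-digits B zero    N<1 = sym (n<1⇒n≡0 N<1)
fromDigits-digits B (suc k) {N} N<B^[1+k] = begin
  N % B + fromDigits B (digits B k (N / B)) * B ≡⟨ cong (λ q → N % B + q * B) (fromDigits-digits B k N/B<B^k) ⟩
  N % B + N / B * B                             ≡⟨ m≡m%n+[m/n]*n N B ⟨
  N                                             ∎
  where
    open ≡-Reasoning
    N/B<B^k : N / B < B ^ k
    N/B<B^k = m<n*o⇒m/o<n (subst (N <_) (*-comm B (B ^ k)) N<B^[1+k])

digits-injective : ∀ B .{{_ : NonZero B}} k {N M} → N < B ^ k → M < B ^ k → digits B k N ≡ digits B k M → N ≡ M
digits-injective B k {N} {M} N< M< eq = begin
  N                          ≡⟨ fromDigits-digits B k N< ⟨
  fromDigits B (digits B k N) ≡⟨ cong (fromDigits B) eq ⟩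
  fromDigits B (digits B k M) ≡⟨ fromDigits-digits B k M< ⟩
  M                          ∎
  where open ≡-Reasoning

fromBit : Bool → ℕ
fromBit false = 0
fromBit true  = 1

toBit : ℕ → Bool
toBit zero    = false
toBit (suc _) = true

fromBit-< : ∀ b → fromBit b < 2
fromBit-< false = s≤s z≤n
fromBit-< true  = s≤s (s≤s z≤n)

fromBit-toBit : ∀ {d} → d < 2 → fromBit (toBit d) ≡ d
fromBit-toBit {zero}        _ = refl
fromBit-toBit {suc zero}    _ = refl
fromBit-toBit {suc (suc _)} (s≤s (s≤s ()))

toBit-fromBit : ∀ b → toBit (fromBit b) ≡ b
toBit-fromBit false = refl
toBit-fromBit true  = refl

[r+q*n]/n≡q : ∀ {r n} q .{{_ : NonZero n}} → r < n → (r + q * n) / n ≡ q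
[r+q*n]/n≡q {r} {n} q r<n = begin
  (r + q * n) / n   ≡⟨ +-distrib-/-∣ʳ r (n∣m*n q) ⟩
  r / n + q * n / n ≡⟨ cong₂ _+_ (m<n⇒m/n≡0 r<n) (m*n/n≡m q n) ⟩
  q                 ∎
  where open ≡-Reasoning

fromBits : ∀ {n} → Vec Bool n → ℕ
fromBits []       = 0
fromBits (b ∷ bs) = fromBit b + fromBits bs * 2

toBits : ∀ n → ℕ → Vec Bool n
toBits zero    N = []
toBits (suc n) N = toBit (N % 2) ∷ toBits n (N / 2)

fromBits-< : ∀ {n} (bs : Vec Bool n) → fromBits bs < 2 ^ n
fromBits-< []               = s≤s z≤n
fromBits-< {suc n} (b ∷ bs) = begin-strict
  fromBit b + fromBits bs * 2 <⟨ +-monoˡ-< (fromBits bs * 2) (fromBit-< b) ⟩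
  2 + fromBits bs * 2         ≡⟨ *-comm (suc (fromBits bs)) 2 ⟩
  2 * suc (fromBits bs)       ≤⟨ *-monoʳ-≤ 2 (fromBits-< bs) ⟩
  2 * 2 ^ n                   ∎
  where open ≤-Reasoning

fromBits-toBits : ∀ n {N} → N < 2 ^ n → fromBits (toBits n N) ≡ N
fromBits-toBits zero    N<1 = sym (n<1⇒n≡0 N<1)
fromBits-toBits (suc n) {N} N<2^[1+n] = begin
  fromBit (toBit (N % 2)) + fromBits (toBits n (N / 2)) * 2
    ≡⟨ cong₂ (λ r q → r + q * 2) (fromBit-toBit (m%n<n N 2)) (fromBits-toBits n N/2<2^n) ⟩
  N % 2 + N / 2 * 2
    ≡⟨ m≡m%n+[m/n]*n N 2 ⟨
  N ∎
  where
    open ≡-Reasoning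
    N/2<2^n : N / 2 < 2 ^ n
    N/2<2^n = m<n*o⇒m/o<n (subst (N <_) (*-comm 2 (2 ^ n)) N<2^[1+n])

toBits-fromBits : ∀ {n} (bs : Vec Bool n) → toBits n (fromBits bs) ≡ bs
toBits-fromBits []       = refl
toBits-fromBits (b ∷ bs) = cong₂ _∷_
  (trans (cong toBit (trans ([m+kn]%n≡m%n (fromBit b) (fromBits bs) 2) (m<n⇒m%n≡m (fromBit-< b))))
         (toBit-fromBit b))
  (trans (cong (toBits _) ([r+q*n]/n≡q (fromBits bs) (fromBit-< b))) (toBits-fromBits bs))

fromBits-injective : ∀ {n} {x y : Vec Bool n} → fromBits x ≡ fromBits y → x ≡ y
fromBits-injective {x = x} {y} eq = trans (sym (toBits-fromBits x)) (trans (cong (toBits _) eq) (toBits-fromBits y))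

toBits-injective : ∀ n {N M} → N < 2 ^ n → M < 2 ^ n → toBits n N ≡ toBits n M → N ≡ M
toBits-injective n N< M< eq = trans (sym (fromBits-toBits n N<)) (trans (cong fromBits eq) (fromBits-toBits n M<))

toBitBlocks : ∀ w {k} → Vec ℕ k → Vec Bool (k * w)
toBitBlocks w []       = []
toBitBlocks w (x ∷ xs) = toBits w x ++ toBitBlocks w xs

toBitBlocks-injective : ∀ w {k} {xs ys : Vec ℕ k} → All (_< 2 ^ w) xs → All (_< 2 ^ w) ys →
                        toBitBlocks w xs ≡ toBitBlocks w ys → xs ≡ ys
toBitBlocks-injective w {xs = []}    {[]}    []           []           _  = refl
toBitBlocks-injective w {xs = x ∷ _} {y ∷ _} (x< ∷ xs<) (y< ∷ ys<) eq =
  cong₂ _∷_ (toBits-injective w x< y< (++-injectiveˡ (toBits w x) (toBits w y) eq))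
            (toBitBlocks-injective w xs< ys< (++-injectiveʳ (toBits w x) (toBits w y) eq))

n<2^n : ∀ n → n < 2 ^ n
n<2^n zero    = s≤s z≤n
n<2^n (suc n) = begin-strict
  suc n         <⟨ s≤s (n<2^n n) ⟩
  1 + 2 ^ n     ≤⟨ +-monoˡ-≤ (2 ^ n) (m^n>0 2 n) ⟩
  2 ^ n + 2 ^ n ≡⟨ cong (λ t → 2 ^ n + t) (+-identityʳ (2 ^ n)) ⟨
  2 * 2 ^ n     ∎
  where open ≤-Reasoning

-- Squared distances

+∣i*i∣≡i*i : ∀ i → + ℤ.∣ i ℤ.* i ∣ ≡ i ℤ.* i
+∣i*i∣≡i*i (+ zero)  = refl
+∣i*i∣≡i*i (+ suc n) = refl
+∣i*i∣≡i*i -[1+ n ]  = refl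

sqDist : ℕ → ℕ → ℕ
sqDist a b = ℤ.∣ (+ a ℤ.- + b) ℤ.* (+ a ℤ.- + b) ∣

+sqDist : ∀ a b → + sqDist a b ≡ (+ a ℤ.- + b) ℤ.* (+ a ℤ.- + b)
+sqDist a b = +∣i*i∣≡i*i (+ a ℤ.- + b)

sqDist≡0⇒≡ : ∀ {a b} → sqDist a b ≡ 0 → a ≡ b
sqDist≡0⇒≡ {a} {b} eq with ℤ.i*j≡0⇒i≡0∨j≡0 (+ a ℤ.- + b) (ℤ.∣i∣≡0⇒i≡0 eq)
... | inj₁ a-b≡0 = ℤ.+-injective (ℤ.i-j≡0⇒i≡j (+ a) (+ b) a-b≡0)
... | inj₂ a-b≡0 = ℤ.+-injective (ℤ.i-j≡0⇒i≡j (+ a) (+ b) a-b≡0)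

sqDist-≤ : ∀ {a b B} → a < B → b < B → sqDist a b ≤ B * B
sqDist-≤ {a} {b} {B} a<B b<B = begin
  sqDist a b                     ≡⟨ ℤ.abs-* (+ a ℤ.- + b) (+ a ℤ.- + b) ⟩
  ℤ.∣ + a ℤ.- + b ∣ * ℤ.∣ + a ℤ.- + b ∣ ≤⟨ *-mono-≤ ∣a-b∣≤B ∣a-b∣≤B ⟩
  B * B                          ∎
  where
    open ≤-Reasoning
    ∣a-b∣≤B : ℤ.∣ + a ℤ.- + b ∣ ≤ B
    ∣a-b∣≤B = begin
      ℤ.∣ + a ℤ.- + b ∣ ≡⟨ cong ℤ.∣_∣ (ℤ.[+m]-[+n]≡m⊖n a b) ⟩
      ℤ.∣ a ℤ.⊖ b ∣     ≤⟨ ℤ.∣m⊝n∣≤m⊔n a b ⟩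
      a ⊔ b             ≤⟨ <⇒≤ (⊔-lub a<B b<B) ⟩
      B                 ∎

sqDist-parallelogram : ∀ {p x y q} → p + y ≡ x + q →
                       sqDist p y + sqDist x q ≡ 2 * (sqDist x y + sqDist p x)
sqDist-parallelogram {p} {x} {y} {q} p+y≡x+q = ℤ.+-injective (begin
  + (sqDist p y + sqDist x q)
    ≡⟨ ℤ.pos-+ (sqDist p y) (sqDist x q) ⟩
  + sqDist p y ℤ.+ + sqDist x q
    ≡⟨ cong₂ ℤ._+_ (+sqDist p y) (+sqDist x q) ⟩
  (+ p ℤ.- + y) ℤ.* (+ p ℤ.- + y) ℤ.+ (+ x ℤ.- + q) ℤ.* (+ x ℤ.- + q)
    ≡⟨ cong (λ t → (+ p ℤ.- + y) ℤ.* (+ p ℤ.- + y) ℤ.+ (+ x ℤ.- t) ℤ.* (+ x ℤ.- t)) +q≡+p++y-+x ⟩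
  (+ p ℤ.- + y) ℤ.* (+ p ℤ.- + y) ℤ.+ (+ x ℤ.- (+ p ℤ.+ + y ℤ.- + x)) ℤ.* (+ x ℤ.- (+ p ℤ.+ + y ℤ.- + x))
    ≡⟨ parallelogram (+ p) (+ x) (+ y) ⟩
  + 2 ℤ.* ((+ x ℤ.- + y) ℤ.* (+ x ℤ.- + y) ℤ.+ (+ p ℤ.- + x) ℤ.* (+ p ℤ.- + x))
    ≡⟨ cong (+ 2 ℤ.*_) (cong₂ ℤ._+_ (+sqDist x y) (+sqDist p x)) ⟨
  + 2 ℤ.* (+ sqDist x y ℤ.+ + sqDist p x)
    ≡⟨ cong (+ 2 ℤ.*_) (ℤ.pos-+ (sqDist x y) (sqDist p x)) ⟨
  + 2 ℤ.* + (sqDist x y + sqDist p x)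
    ≡⟨ ℤ.pos-* 2 (sqDist x y + sqDist p x) ⟨
  + (2 * (sqDist x y + sqDist p x)) ∎)
  where
    open ≡-Reasoning
    parallelogram : ∀ p x y → (p ℤ.- y) ℤ.* (p ℤ.- y) ℤ.+ (x ℤ.- (p ℤ.+ y ℤ.- x)) ℤ.* (x ℤ.- (p ℤ.+ y ℤ.- x))
                              ≡ + 2 ℤ.* ((x ℤ.- y) ℤ.* (x ℤ.- y) ℤ.+ (p ℤ.- x) ℤ.* (p ℤ.- x))
    parallelogram = ℤ-Solver.solve-∀
    q≡[x+q]-x : ∀ x q → q ≡ x ℤ.+ q ℤ.- x
    q≡[x+q]-x = ℤ-Solver.solve-∀
    +q≡+p++y-+x : + q ≡ + p ℤ.+ + y ℤ.- + x
    +q≡+p++y-+x = begin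
      + q                   ≡⟨ q≡[x+q]-x (+ x) (+ q) ⟩
      + x ℤ.+ + q ℤ.- + x   ≡⟨ cong (ℤ._- + x) (ℤ.pos-+ x q) ⟨
      + (x + q) ℤ.- + x     ≡⟨ cong (λ t → + t ℤ.- + x) p+y≡x+q ⟨
      + (p + y) ℤ.- + x     ≡⟨ cong (ℤ._- + x) (ℤ.pos-+ p y) ⟩
      + p ℤ.+ + y ℤ.- + x   ∎

sqDistance : ∀ {k} → Vec ℕ k → Vec ℕ k → ℕ
sqDistance xs ys = sum (zipWith sqDist xs ys)

sqDistance-≤ : ∀ {k B} {a b : Vec ℕ k} → All (_< B) a → All (_< B) b → sqDistance a b ≤ k * (B * B)
sqDistance-≤ []         []         = z≤n
sqDistance-≤ (a< ∷ as<) (b< ∷ bs<) = +-mono-≤ (sqDist-≤ a< b<) (sqDistance-≤ as< bs<)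

infixl 6 _⊕_
_⊕_ : ∀ {k} → Vec ℕ k → Vec ℕ k → Vec ℕ k
_⊕_ = zipWith _+_

⊕-cancelˡ : ∀ {k} (a : Vec ℕ k) {b c} → a ⊕ b ≡ a ⊕ c → b ≡ c
⊕-cancelˡ []      {[]}    {[]}    _  = refl
⊕-cancelˡ (a ∷ as) {_ ∷ _} {_ ∷ _} eq =
  let (head≡ , tail≡) = ∷-injective eq in cong₂ _∷_ (+-cancelˡ-≡ a _ _ head≡) (⊕-cancelˡ as tail≡)

⊕-cancelʳ : ∀ {k} {a b : Vec ℕ k} c → a ⊕ c ≡ b ⊕ c → a ≡ b
⊕-cancelʳ {a = []}    {[]}    []       _  = refl
⊕-cancelʳ {a = _ ∷ _} {_ ∷ _} (c ∷ cs) eq =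
  let (head≡ , tail≡) = ∷-injective eq in cong₂ _∷_ (+-cancelʳ-≡ c _ _ head≡) (⊕-cancelʳ cs tail≡)

sqDistance≡0⇒≡ : ∀ {k} {xs ys : Vec ℕ k} → sqDistance xs ys ≡ 0 → xs ≡ ys
sqDistance≡0⇒≡ {xs = []}    {[]}    _  = refl
sqDistance≡0⇒≡ {xs = x ∷ _} {y ∷ _} eq =
  cong₂ _∷_ (sqDist≡0⇒≡ (m+n≡0⇒m≡0 (sqDist x y) eq)) (sqDistance≡0⇒≡ (m+n≡0⇒n≡0 (sqDist x y) eq))

sqDistance-parallelogram : ∀ {k} {p x y q : Vec ℕ k} → p ⊕ y ≡ x ⊕ q →
  sqDistance p y + sqDistance x q ≡ 2 * (sqDistance x y + sqDistance p x)
sqDistance-parallelogram {p = []} {[]} {[]} {[]} _ = refl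
sqDistance-parallelogram {p = p ∷ ps} {x ∷ xs} {y ∷ ys} {q ∷ qs} eq =
  let (head≡ , tail≡) = ∷-injective eq in begin
    (sqDist p y + sqDistance ps ys) + (sqDist x q + sqDistance xs qs)
      ≡⟨ +-interchange (sqDist p y) (sqDistance ps ys) (sqDist x q) (sqDistance xs qs) ⟩
    (sqDist p y + sqDist x q) + (sqDistance ps ys + sqDistance xs qs)
      ≡⟨ cong₂ _+_ (sqDist-parallelogram {p} {x} {y} {q} head≡) (sqDistance-parallelogram tail≡) ⟩
    2 * (sqDist x y + sqDist p x) + 2 * (sqDistance xs ys + sqDistance ps xs)
      ≡⟨ *-distribˡ-+ 2 (sqDist x y + sqDist p x) (sqDistance xs ys + sqDistance ps xs) ⟨
    2 * ((sqDist x y + sqDist p x) + (sqDistance xs ys + sqDistance ps xs))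
      ≡⟨ cong (2 *_) (+-interchange (sqDist x y) (sqDist p x) (sqDistance xs ys) (sqDistance ps xs)) ⟩
    2 * ((sqDist x y + sqDistance xs ys) + (sqDist p x + sqDistance ps xs)) ∎
  where open ≡-Reasoning

parallelogram-degenerate : ∀ {k} {p x y q : Vec ℕ k} → p ⊕ y ≡ x ⊕ q →
  sqDistance p y ≡ sqDistance x y → sqDistance x q ≡ sqDistance x y → p ≡ x
parallelogram-degenerate {p = p} {x} {y} {q} eq py≡xy xq≡xy =
  sqDistance≡0⇒≡ (+-cancelˡ-≡ D (sqDistance p x) 0 (*-cancelˡ-≡ _ _ 2 (begin
    2 * (D + sqDistance p x)        ≡⟨ sqDistance-parallelogram eq ⟨
    sqDistance p y + sqDistance x q ≡⟨ cong₂ _+_ py≡xy xq≡xy ⟩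
    D + D                           ≡⟨ cong (λ t → D + t) (+-identityʳ D) ⟨
    2 * D                           ≡⟨ cong (2 *_) (+-identityʳ D) ⟨
    2 * (D + 0)                     ∎)))
  where
    open ≡-Reasoning
    D : ℕ
    D = sqDistance x y

-- Corner-injective codes

CornerInjective : {S W : Set} → (S → S → S → W) → Set
CornerInjective f = ∀ {x x′ y y′ z z′} → f x′ y z ≡ f x y′ z → f x′ y z ≡ f x y z′ →
                    x′ ≡ x × y′ ≡ y × z′ ≡ z

sumAndDistance : ∀ {k} → Vec ℕ k → Vec ℕ k → Vec ℕ k → Vec ℕ k × ℕ
sumAndDistance a b c = (a ⊕ b ⊕ c , sqDistance a b)

sumAndDistance-cornerInjective : ∀ {k} → CornerInjective (sumAndDistance {k})
sumAndDistance-cornerInjective {x = x} {x′} {y} {y′} {z} {z′} e₁ e₂ = x′≡x , y′≡y , z′≡z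
  where
    x′⊕y≡x⊕y′ : x′ ⊕ y ≡ x ⊕ y′
    x′⊕y≡x⊕y′ = ⊕-cancelʳ z (cong proj₁ e₁)
    x′≡x : x′ ≡ x
    x′≡x = parallelogram-degenerate x′⊕y≡x⊕y′ (cong proj₂ e₂) (trans (sym (cong proj₂ e₁)) (cong proj₂ e₂))
    y′≡y : y′ ≡ y
    y′≡y = sym (⊕-cancelˡ x (subst (λ t → t ⊕ y ≡ x ⊕ y′) x′≡x x′⊕y≡x⊕y′))
    z′≡z : z′ ≡ z
    z′≡z = sym (⊕-cancelˡ (x ⊕ y) (subst (λ t → t ⊕ y ⊕ z ≡ x ⊕ y ⊕ z′) x′≡x (cong proj₁ e₂)))

cornerInjective-precompose : ∀ {S S′ W : Set} {f : S → S → S → W} {φ : S′ → S} →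
  CornerInjective f → Injective _≡_ _≡_ φ → CornerInjective (λ x y z → f (φ x) (φ y) (φ z))
cornerInjective-precompose f-inj φ-inj e₁ e₂ =
  let (x′≡x , y′≡y , z′≡z) = f-inj e₁ e₂ in φ-inj x′≡x , φ-inj y′≡y , φ-inj z′≡z

cornerInjective-postcompose : ∀ {S W W′ : Set} {f : S → S → S → W} {h : W → W′} (P : W → Set) →
  (∀ x y z → P (f x y z)) → (∀ {u v} → P u → P v → h u ≡ h v → u ≡ v) →
  CornerInjective f → CornerInjective (λ x y z → h (f x y z))
cornerInjective-postcompose P f∈P h-inj f-inj e₁ e₂ =
  f-inj (h-inj (f∈P _ _ _) (f∈P _ _ _) e₁) (h-inj (f∈P _ _ _) (f∈P _ _ _) e₂)

module BlockCode (s kk : ℕ) where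

  instance
    2^s≢0 : NonZero (2 ^ s)
    2^s≢0 = m^n≢0 2 s

  blocks : ∀ {n} → Vec Bool n → Vec ℕ kk
  blocks x = digits (2 ^ s) kk (fromBits x)

  blocks-injective : ∀ {n} → n ≤ s * kk → Injective _≡_ _≡_ (blocks {n})
  blocks-injective {n} n≤s*kk {x} {y} eq =
    fromBits-injective (digits-injective (2 ^ s) kk (bound x) (bound y) eq)
    where
      bound : ∀ x → fromBits x < (2 ^ s) ^ kk
      bound x = <-≤-trans (fromBits-< x)
                          (subst (2 ^ n ≤_) (sym (^-*-assoc 2 s kk)) (^-monoʳ-≤ 2 n≤s*kk))

  codeLength : ℕ
  codeLength = kk * (2 + s) + (kk + (s + s))

  Encodable : Vec ℕ kk × ℕ → Set
  Encodable (v , d) = All (_< 2 ^ (2 + s)) v × d < 2 ^ (kk + (s + s))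

  encode : Vec ℕ kk × ℕ → Vec Bool codeLength
  encode (v , d) = toBitBlocks (2 + s) v ++ toBits (kk + (s + s)) d

  encode-injective : ∀ {u v} → Encodable u → Encodable v → encode u ≡ encode v → u ≡ v
  encode-injective {v₁ , d₁} {v₂ , d₂} (v₁< , d₁<) (v₂< , d₂<) eq = cong₂ _,_
    (toBitBlocks-injective (2 + s) v₁< v₂< (++-injectiveˡ (toBitBlocks (2 + s) v₁) (toBitBlocks (2 + s) v₂) eq))
    (toBits-injective (kk + (s + s)) d₁< d₂< (++-injectiveʳ (toBitBlocks (2 + s) v₁) (toBitBlocks (2 + s) v₂) eq))

  ⊕-< : ∀ {k} {a b c : Vec ℕ k} → All (_< 2 ^ s) a → All (_< 2 ^ s) b → All (_< 2 ^ s) c →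
        All (_< 2 ^ (2 + s)) (a ⊕ b ⊕ c)
  ⊕-< []           []           []           = []
  ⊕-< (a< ∷ as<) (b< ∷ bs<) (c< ∷ cs<) = sum< a< b< c< ∷ ⊕-< as< bs< cs<
    where
      sum< : ∀ {a b c} → a < 2 ^ s → b < 2 ^ s → c < 2 ^ s → a + b + c < 2 ^ (2 + s)
      sum< {a} {b} {c} a< b< c< = begin-strict
        a + b + c                   <⟨ +-mono-< (+-mono-< a< b<) c< ⟩
        2 ^ s + 2 ^ s + 2 ^ s       ≤⟨ m≤m+n _ (2 ^ s) ⟩
        2 ^ s + 2 ^ s + 2 ^ s + 2 ^ s ≡⟨ x+x+x+x≡2*[2*x] (2 ^ s) ⟩
        2 * (2 * 2 ^ s)             ∎
        where
          open ≤-Reasoning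
          x+x+x+x≡2*[2*x] : ∀ x → x + x + x + x ≡ 2 * (2 * x)
          x+x+x+x≡2*[2*x] = solve-∀

  sumAndDistance-encodable : ∀ {a b c : Vec ℕ kk} → All (_< 2 ^ s) a → All (_< 2 ^ s) b → All (_< 2 ^ s) c →
                             Encodable (sumAndDistance a b c)
  sumAndDistance-encodable {a} {b} a< b< c< = ⊕-< a< b< c< , (begin-strict
    sqDistance a b             ≤⟨ sqDistance-≤ a< b< ⟩
    kk * (2 ^ s * 2 ^ s)       <⟨ *-monoˡ-< (2 ^ s * 2 ^ s) {{m*n≢0 (2 ^ s) (2 ^ s)}} (n<2^n kk) ⟩
    2 ^ kk * (2 ^ s * 2 ^ s)   ≡⟨ cong (2 ^ kk *_) (^-distribˡ-+-* 2 s s) ⟨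
    2 ^ kk * 2 ^ (s + s)       ≡⟨ ^-distribˡ-+-* 2 kk (s + s) ⟨
    2 ^ (kk + (s + s))         ∎)
    where open ≤-Reasoning

  code : ∀ {n} → Vec Bool n → Vec Bool n → Vec Bool n → Vec Bool codeLength
  code x y z = encode (sumAndDistance (blocks x) (blocks y) (blocks z))

  code-cornerInjective : ∀ {n} → n ≤ s * kk → CornerInjective (code {n})
  code-cornerInjective n≤s*kk =
    cornerInjective-postcompose Encodable
      (λ x y z → sumAndDistance-encodable (blocks-< x) (blocks-< y) (blocks-< z)) encode-injective
      (cornerInjective-precompose sumAndDistance-cornerInjective (blocks-injective n≤s*kk))
    where
      blocks-< : ∀ {n} (x : Vec Bool n) → All (_< 2 ^ s) (blocks x)
      blocks-< x = digits-< (2 ^ s) kk (fromBits x)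

-- Protocols

private
  variable
    X Y Z X′ Y′ Z′ : Set

announce : ∀ L → (X → Vec Bool L) → (Vec Bool L → Y → Bool) → (Vec Bool L → Z → Bool) →
           Protocol X Y Z
announce zero    f g h = leaf (λ _ → true) (g []) (h [])
announce (suc L) f g h =
  speakA (head ∘ f) (announce L (tail ∘ f) (g ∘ (false ∷_)) (h ∘ (false ∷_)))
                    (announce L (tail ∘ f) (g ∘ (true ∷_))  (h ∘ (true ∷_)))

run-announce : ∀ L (f : X → Vec Bool L) g (h : Vec Bool L → Z → Bool) a (b : Y) c →
               run (announce L f g h) a b c ≡ (g (f a) b ∧ h (f a) c)
run-announce zero    f g h a b c with f a
... | [] = refl
run-announce (suc L) f g h a b c with f a in eq
... | false ∷ _ = trans (run-announce L (tail ∘ f) (g ∘ (false ∷_)) (h ∘ (false ∷_)) a b c)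
                        (cong (λ w → g (false ∷ w) b ∧ h (false ∷ w) c) (cong tail eq))
... | true ∷ _ = trans (run-announce L (tail ∘ f) (g ∘ (true ∷_)) (h ∘ (true ∷_)) a b c)
                        (cong (λ w → g (true ∷ w) b ∧ h (true ∷ w) c) (cong tail eq))

cost-announce : ∀ L (f : X → Vec Bool L) (g : Vec Bool L → Y → Bool) (h : Vec Bool L → Z → Bool) →
                cost (announce L f g h) ≡ L
cost-announce zero    f g h = refl
cost-announce (suc L) f g h =
  cong suc (trans (cong₂ _⊔_ (cost-announce L _ _ _) (cost-announce L _ _ _)) (⊔-idem L))

sameWord : ∀ {L} → Vec Bool L → Vec Bool L → Bool
sameWord u v = ⌊ ≡-dec Bool._≟_ u v ⌋

T-sameWord : ∀ {L} (u v : Vec Bool L) → T (sameWord u v) ⇔ u ≡ v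
T-sameWord u v = mk⇔ toWitness fromWitness

T-cong : ∀ {b b′} → b ≡ b′ → T b ⇔ T b′
T-cong refl = ⇔.refl

announceEq : ∀ L → (X → Vec Bool L) → (Y → Vec Bool L) → (Z → Vec Bool L) → Protocol X Y Z
announceEq L f g h = announce L f (λ w → sameWord w ∘ g) (λ w → sameWord w ∘ h)

run-announceEq : ∀ L (f : X → Vec Bool L) (g : Y → Vec Bool L) (h : Z → Vec Bool L) a b c →
                 T (run (announceEq L f g h) a b c) ⇔ (f a ≡ g b × f a ≡ h c)
run-announceEq L f g h a b c =
  ⇔.trans (T-cong (run-announce L f _ _ a b c))
          (⇔.trans T-∧ (T-sameWord (f a) (g b) ×-⇔ T-sameWord (f a) (h c)))

ccLE-announceEq : ∀ (Q : PromiseProblem) L f g h →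
  (∀ a b c → promise Q a b c → (f a ≡ g b × f a ≡ h c) ⇔ accept Q a b c) → ccLE Q L
ccLE-announceEq Q L f g h correct =
  announceEq L f g h ,
  (λ a b c p → ⇔.trans (run-announceEq L f g h a b c) (correct a b c p)) ,
  ≤-reflexive (cost-announce L f _ _)

-- Kronecker products

conjoinLeaf : (X → Bool) → (Y → Bool) → (Z → Bool) → Protocol X′ Y′ Z′ →
              Protocol (X × X′) (Y × Y′) (Z × Z′)
conjoinLeaf fa fb fc (leaf ga gb gc) =
  leaf (λ (a , a′) → fa a ∧ ga a′) (λ (b , b′) → fb b ∧ gb b′) (λ (c , c′) → fc c ∧ gc c′)
conjoinLeaf fa fb fc (speakA f p q) = speakA (f ∘ proj₂) (conjoinLeaf fa fb fc p) (conjoinLeaf fa fb fc q)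
conjoinLeaf fa fb fc (speakB f p q) = speakB (f ∘ proj₂) (conjoinLeaf fa fb fc p) (conjoinLeaf fa fb fc q)
conjoinLeaf fa fb fc (speakC f p q) = speakC (f ∘ proj₂) (conjoinLeaf fa fb fc p) (conjoinLeaf fa fb fc q)

_⊗ₚ_ : Protocol X Y Z → Protocol X′ Y′ Z′ → Protocol (X × X′) (Y × Y′) (Z × Z′)
leaf fa fb fc ⊗ₚ q = conjoinLeaf fa fb fc q
speakA f p p′ ⊗ₚ q = speakA (f ∘ proj₁) (p ⊗ₚ q) (p′ ⊗ₚ q)
speakB f p p′ ⊗ₚ q = speakB (f ∘ proj₁) (p ⊗ₚ q) (p′ ⊗ₚ q)
speakC f p p′ ⊗ₚ q = speakC (f ∘ proj₁) (p ⊗ₚ q) (p′ ⊗ₚ q)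

run-conjoinLeaf : ∀ (fa : X → Bool) (fb : Y → Bool) (fc : Z → Bool) (q : Protocol X′ Y′ Z′) a b c a′ b′ c′ →
  run (conjoinLeaf fa fb fc q) (a , a′) (b , b′) (c , c′) ≡ ((fa a ∧ fb b ∧ fc c) ∧ run q a′ b′ c′)
run-conjoinLeaf fa fb fc (leaf ga gb gc) a b c a′ b′ c′ =
  trans (cong ((fa a ∧ ga a′) ∧_) (∧-interchange (fb b) (gb b′) (fc c) (gc c′)))
        (∧-interchange (fa a) (ga a′) (fb b ∧ fc c) (gb b′ ∧ gc c′))
run-conjoinLeaf fa fb fc (speakA f p q) a b c a′ b′ c′ with f a′
... | false = run-conjoinLeaf fa fb fc p a b c a′ b′ c′
... | true  = run-conjoinLeaf fa fb fc q a b c a′ b′ c′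
run-conjoinLeaf fa fb fc (speakB f p q) a b c a′ b′ c′ with f b′
... | false = run-conjoinLeaf fa fb fc p a b c a′ b′ c′
... | true  = run-conjoinLeaf fa fb fc q a b c a′ b′ c′
run-conjoinLeaf fa fb fc (speakC f p q) a b c a′ b′ c′ with f c′
... | false = run-conjoinLeaf fa fb fc p a b c a′ b′ c′
... | true  = run-conjoinLeaf fa fb fc q a b c a′ b′ c′

run-⊗ₚ : ∀ (p : Protocol X Y Z) (q : Protocol X′ Y′ Z′) a b c a′ b′ c′ →
         run (p ⊗ₚ q) (a , a′) (b , b′) (c , c′) ≡ (run p a b c ∧ run q a′ b′ c′)
run-⊗ₚ (leaf fa fb fc) q a b c a′ b′ c′ = run-conjoinLeaf fa fb fc q a b c a′ b′ c′
run-⊗ₚ (speakA f p p′) q a b c a′ b′ c′ with f a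
... | false = run-⊗ₚ p q a b c a′ b′ c′
... | true  = run-⊗ₚ p′ q a b c a′ b′ c′
run-⊗ₚ (speakB f p p′) q a b c a′ b′ c′ with f b
... | false = run-⊗ₚ p q a b c a′ b′ c′
... | true  = run-⊗ₚ p′ q a b c a′ b′ c′
run-⊗ₚ (speakC f p p′) q a b c a′ b′ c′ with f c
... | false = run-⊗ₚ p q a b c a′ b′ c′
... | true  = run-⊗ₚ p′ q a b c a′ b′ c′

cost-conjoinLeaf : ∀ (fa : X → Bool) (fb : Y → Bool) (fc : Z → Bool) (q : Protocol X′ Y′ Z′) →
                   cost (conjoinLeaf fa fb fc q) ≡ cost q
cost-conjoinLeaf fa fb fc (leaf _ _ _)   = refl
cost-conjoinLeaf fa fb fc (speakA f p q) = cong suc (cong₂ _⊔_ (cost-conjoinLeaf fa fb fc p) (cost-conjoinLeaf fa fb fc q))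
cost-conjoinLeaf fa fb fc (speakB f p q) = cong suc (cong₂ _⊔_ (cost-conjoinLeaf fa fb fc p) (cost-conjoinLeaf fa fb fc q))
cost-conjoinLeaf fa fb fc (speakC f p q) = cong suc (cong₂ _⊔_ (cost-conjoinLeaf fa fb fc p) (cost-conjoinLeaf fa fb fc q))

⊔-≤-⊔-+ : ∀ {x y} a b c → x ≤ a + c → y ≤ b + c → x ⊔ y ≤ (a ⊔ b) + c
⊔-≤-⊔-+ {x} {y} a b c x≤ y≤ = subst (x ⊔ y ≤_) (sym (+-distribʳ-⊔ c a b)) (⊔-mono-≤ x≤ y≤)

cost-⊗ₚ : ∀ (p : Protocol X Y Z) (q : Protocol X′ Y′ Z′) → cost (p ⊗ₚ q) ≤ cost p + cost q
cost-⊗ₚ (leaf fa fb fc) q = ≤-reflexive (cost-conjoinLeaf fa fb fc q)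
cost-⊗ₚ (speakA f p p′) q = s≤s (⊔-≤-⊔-+ (cost p) (cost p′) (cost q) (cost-⊗ₚ p q) (cost-⊗ₚ p′ q))
cost-⊗ₚ (speakB f p p′) q = s≤s (⊔-≤-⊔-+ (cost p) (cost p′) (cost q) (cost-⊗ₚ p q) (cost-⊗ₚ p′ q))
cost-⊗ₚ (speakC f p p′) q = s≤s (⊔-≤-⊔-+ (cost p) (cost p′) (cost q) (cost-⊗ₚ p q) (cost-⊗ₚ p′ q))

ccLE-⊗ : ∀ {Q R c d} → ccLE Q c → ccLE R d → ccLE (Q ⊗ R) (c + d)
ccLE-⊗ {Q} {R} (p , p-solves , p-cost) (q , q-solves , q-cost) =
  p ⊗ₚ q , solves , ≤-trans (cost-⊗ₚ p q) (+-mono-≤ p-cost q-cost)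
  where
    solves : Solves (Q ⊗ R) (p ⊗ₚ q)
    solves (a , a′) (b , b′) (c , c′) (π , π′) =
      ⇔.trans (T-cong (run-⊗ₚ p q a b c a′ b′ c′))
              (⇔.trans T-∧ (p-solves a b c π ×-⇔ q-solves a′ b′ c′ π′))

relabel : (X′ → X) → (Y′ → Y) → (Z′ → Z) → Protocol X Y Z → Protocol X′ Y′ Z′
relabel α β γ (leaf fa fb fc) = leaf (fa ∘ α) (fb ∘ β) (fc ∘ γ)
relabel α β γ (speakA f p q)  = speakA (f ∘ α) (relabel α β γ p) (relabel α β γ q)
relabel α β γ (speakB f p q)  = speakB (f ∘ β) (relabel α β γ p) (relabel α β γ q)
relabel α β γ (speakC f p q)  = speakC (f ∘ γ) (relabel α β γ p) (relabel α β γ q)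

run-relabel : ∀ (α : X′ → X) (β : Y′ → Y) (γ : Z′ → Z) p a b c →
              run (relabel α β γ p) a b c ≡ run p (α a) (β b) (γ c)
run-relabel α β γ (leaf _ _ _) a b c = refl
run-relabel α β γ (speakA f p q) a b c with f (α a)
... | false = run-relabel α β γ p a b c
... | true  = run-relabel α β γ q a b c
run-relabel α β γ (speakB f p q) a b c with f (β b)
... | false = run-relabel α β γ p a b c
... | true  = run-relabel α β γ q a b c
run-relabel α β γ (speakC f p q) a b c with f (γ c)
... | false = run-relabel α β γ p a b c
... | true  = run-relabel α β γ q a b c

cost-relabel : ∀ (α : X′ → X) (β : Y′ → Y) (γ : Z′ → Z) p → cost (relabel α β γ p) ≡ cost p
cost-relabel α β γ (leaf _ _ _)   = refl
cost-relabel α β γ (speakA f p q) = cong suc (cong₂ _⊔_ (cost-relabel α β γ p) (cost-relabel α β γ q))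
cost-relabel α β γ (speakB f p q) = cong suc (cong₂ _⊔_ (cost-relabel α β γ p) (cost-relabel α β γ q))
cost-relabel α β γ (speakC f p q) = cong suc (cong₂ _⊔_ (cost-relabel α β γ p) (cost-relabel α β γ q))

infix 4 _≼_
record _≼_ (R Q : PromiseProblem) : Set where
  field
    onA : A R → A Q
    onB : B R → B Q
    onC : C R → C Q
    promise⇒ : ∀ {a b c} → promise R a b c → promise Q (onA a) (onB b) (onC c)
    accept⇔  : ∀ {a b c} → promise R a b c → accept Q (onA a) (onB b) (onC c) ⇔ accept R a b c
open _≼_

ccLE-≼ : ∀ {R Q c} → R ≼ Q → ccLE Q c → ccLE R c
ccLE-≼ {R} {Q} {c} r (p , p-solves , p-cost) =
  relabel (onA r) (onB r) (onC r) p , solves , subst (_≤ c) (sym (cost-relabel _ _ _ p)) p-cost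
  where
    solves : Solves R (relabel (onA r) (onB r) (onC r) p)
    solves a b c π =
      ⇔.trans (T-cong (run-relabel _ _ _ p a b c))
              (⇔.trans (p-solves _ _ _ (promise⇒ r π)) (accept⇔ r π))

≼-trans : ∀ {Q R S} → Q ≼ R → R ≼ S → Q ≼ S
≼-trans r s = record
  { onA = onA s ∘ onA r ; onB = onB s ∘ onB r ; onC = onC s ∘ onC r
  ; promise⇒ = promise⇒ s ∘ promise⇒ r
  ; accept⇔ = λ π → ⇔.trans (accept⇔ s (promise⇒ r π)) (accept⇔ r π) }

⊗-monoʳ-≼ : ∀ {Q R S} → R ≼ S → Q ⊗ R ≼ Q ⊗ S
⊗-monoʳ-≼ r = record
  { onA = map₂ (onA r) ; onB = map₂ (onB r) ; onC = map₂ (onC r)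
  ; promise⇒ = map₂ (promise⇒ r)
  ; accept⇔ = λ (_ , π) → ⇔.refl ×-⇔ accept⇔ r π }

⊗-assoc : ∀ {Q R S} → Q ⊗ (R ⊗ S) ≼ (Q ⊗ R) ⊗ S
⊗-assoc = record
  { onA = reassoc ; onB = reassoc ; onC = reassoc
  ; promise⇒ = reassoc
  ; accept⇔ = λ _ → mk⇔ (λ ((α , β) , γ) → α , β , γ) reassoc }
  where
    reassoc : ∀ {U V W : Set} → U × (V × W) → (U × V) × W
    reassoc (u , v , w) = (u , v) , w

⊗-identityˡ : ∀ {Q} → Q ≼ trivialProblem ⊗ Q
⊗-identityˡ = record
  { onA = tt ,_ ; onB = tt ,_ ; onC = tt ,_
  ; promise⇒ = tt ,_
  ; accept⇔ = λ _ → mk⇔ proj₂ (tt ,_) }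

⊗-identityʳ : ∀ {Q} → Q ⊗ trivialProblem ≼ Q
⊗-identityʳ = record
  { onA = proj₁ ; onB = proj₁ ; onC = proj₁
  ; promise⇒ = proj₁
  ; accept⇔ = λ _ → mk⇔ (_, tt) proj₁ }

⊗^-+ : ∀ {Q} a b → Q ⊗^ (a + b) ≼ (Q ⊗^ a) ⊗ (Q ⊗^ b)
⊗^-+ zero    b = ⊗-identityˡ
⊗^-+ (suc a) b = ≼-trans (⊗-monoʳ-≼ (⊗^-+ a b)) ⊗-assoc

⊗^-3 : ∀ {Q} → Q ⊗^ 3 ≼ (Q ⊗ Q) ⊗ Q
⊗^-3 = ≼-trans (⊗-monoʳ-≼ (⊗-monoʳ-≼ ⊗-identityʳ)) ⊗-assoc

ccLE-trivial : ccLE trivialProblem 0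
ccLE-trivial = leaf (λ _ → true) (λ _ → true) (λ _ → true) , (λ _ _ _ _ → mk⇔ _ _) , z≤n

ccLE-⊗^-* : ∀ {Q a c} → ccLE (Q ⊗^ a) c → ∀ q → ccLE (Q ⊗^ (q * a)) (q * c)
ccLE-⊗^-* h zero          = ccLE-trivial
ccLE-⊗^-* {a = a} h (suc q) = ccLE-≼ (⊗^-+ a (q * a)) (ccLE-⊗ h (ccLE-⊗^-* h q))

ccLE-⊗^-triples : ∀ {Q n c₃} → ccLE Q n → ccLE (Q ⊗^ 3) c₃ → ∀ m → ccLE (Q ⊗^ m) (m % 3 * n + m / 3 * c₃)
ccLE-⊗^-triples {Q} {n} {c₃} h₁ h₃ m =
  subst (λ k → ccLE (Q ⊗^ k) (m % 3 * n + m / 3 * c₃)) (sym m≡[m%3]*1+[m/3]*3)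
        (ccLE-≼ (⊗^-+ (m % 3 * 1) (m / 3 * 3))
                (ccLE-⊗ (ccLE-⊗^-* (ccLE-≼ ⊗-identityʳ h₁) (m % 3)) (ccLE-⊗^-* h₃ (m / 3))))
  where
    m≡[m%3]*1+[m/3]*3 : m ≡ m % 3 * 1 + m / 3 * 3
    m≡[m%3]*1+[m/3]*3 = trans (m≡m%n+[m/n]*n m 3) (cong (_+ m / 3 * 3) (sym (*-identityʳ (m % 3))))

-- NOF permutation problems

exactlyOne⇔ : ∀ {S : Set} {P : S → Set} (e : ExactlyOne P) z → P z ⇔ z ≡ proj₁ e
exactlyOne⇔ (_ , Pz , unique) z = mk⇔ (unique z) (λ { refl → Pz })

module NOFPermutation {S : Set} {I : S → S → S → Bool} (perm : IsNOFPermutation I) where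
  third : S → S → S
  third x y = proj₁ (proj₁ perm x y)

  first : S → S → S
  first y z = proj₁ (proj₁ (proj₂ perm) y z)

  second : S → S → S
  second x z = proj₁ (proj₂ (proj₂ perm) x z)

  T⇔≡third : ∀ x y z → T (I x y z) ⇔ z ≡ third x y
  T⇔≡third x y = exactlyOne⇔ (proj₁ perm x y)

  T⇔≡first : ∀ x y z → T (I x y z) ⇔ x ≡ first y z
  T⇔≡first x y z = exactlyOne⇔ (proj₁ (proj₂ perm) y z) x

  T⇔≡second : ∀ x y z → T (I x y z) ⇔ y ≡ second x z
  T⇔≡second x y z = exactlyOne⇔ (proj₂ (proj₂ perm) x z) y

ccLE-NOFProblem : ∀ {L} {I : Vec Bool L → Vec Bool L → Vec Bool L → Bool} →
                  IsNOFPermutation I → ccLE (NOFProblem I) L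
ccLE-NOFProblem {L} {I} perm =
  ccLE-announceEq (NOFProblem I) L (λ (i , j) → third i j) proj₂ proj₁
    λ { (i , j) (_ , k) _ π@(refl , refl , refl) →
        mk⇔ (λ (e , _) → π , Equivalence.from (T⇔≡third i j k) (sym e))
            (λ (_ , t) → let e = sym (Equivalence.to (T⇔≡third i j k) t) in e , e) }
  where open NOFPermutation perm

ccLE-triple : ∀ {S : Set} {I J K : S → S → S → Bool} L (code : S → S → S → Vec Bool L) →
              CornerInjective code →
              IsNOFPermutation I → IsNOFPermutation J → IsNOFPermutation K →
              ccLE (triple I J K) L
ccLE-triple {I = I} {J} {K} L code injective permI permJ permK =
  ccLE-announceEq (triple I J K) L
    (λ (((i₁ , j₁) , (i₂ , _)) , (_ , j₃)) → code (I′.third i₁ j₁) i₂ j₃)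
    (λ (((_ , k₁) , (j₂ , k₂)) , (j₃ , _)) → code k₁ (J′.first j₂ k₂) j₃)
    (λ (((k₁ , _) , (_ , i₂)) , (k₃ , i₃)) → code k₁ i₂ (K′.second i₃ k₃))
    λ { (((i₁ , j₁) , (i₂ , j₂)) , (i₃ , j₃)) (((_ , k₁) , (_ , k₂)) , (_ , k₃)) _
        ((π₁@(refl , refl , refl) , π₂@(refl , refl , refl)) , π₃@(refl , refl , refl)) →
        mk⇔ (λ (e , e′) → let (k₁≡ , i₂≡ , j₃≡) = injective e e′ in
               ((π₁ , Equivalence.from (I′.T⇔≡third i₁ j₁ k₁) (sym k₁≡)) ,
                (π₂ , Equivalence.from (J′.T⇔≡first i₂ j₂ k₂) (sym i₂≡))) ,
                (π₃ , Equivalence.from (K′.T⇔≡second i₃ j₃ k₃) (sym j₃≡)))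
            (λ (((_ , tI) , (_ , tJ)) , (_ , tK)) →
               let k₁≡ = Equivalence.to (I′.T⇔≡third i₁ j₁ k₁) tI
                   i₂≡ = Equivalence.to (J′.T⇔≡first i₂ j₂ k₂) tJ
                   j₃≡ = Equivalence.to (K′.T⇔≡second i₃ j₃ k₃) tK
               in cong₂ (λ k i → code k i j₃) (sym k₁≡) i₂≡ , cong₂ (λ k j → code k i₂ j) (sym k₁≡) j₃≡) }
  where
    module I′ = NOFPermutation permI
    module J′ = NOFPermutation permJ
    module K′ = NOFPermutation permK

n≤s*[1+n/s] : ∀ n s .{{_ : NonZero s}} → n ≤ s * suc (n / s)
n≤s*[1+n/s] n s = <⇒≤ (begin-strict
  n                 ≡⟨ m≡m%n+[m/n]*n n s ⟩
  n % s + n / s * s <⟨ +-monoˡ-< (n / s * s) (m%n<n n s) ⟩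
  suc (n / s) * s   ≡⟨ *-comm (suc (n / s)) s ⟩
  s * suc (n / s)   ∎)
  where open ≤-Reasoning

s*[1+n/s]≤s+n : ∀ n s .{{_ : NonZero s}} → s * suc (n / s) ≤ s + n
s*[1+n/s]≤s+n n s = begin
  s * suc (n / s)   ≡⟨ *-comm s (suc (n / s)) ⟩
  s + n / s * s     ≤⟨ +-monoʳ-≤ s (m/n*n≤m n s) ⟩
  s + n             ∎
  where open ≤-Reasoning

codeLength-≤ : ∀ E .{{_ : NonZero E}} n kk → 6 * E * kk ≤ 6 * E + n → 6 * E * (6 * E) + 6 * E ≤ n →
               E * BlockCode.codeLength (6 * E) kk ≤ suc E * n
codeLength-≤ E n kk s*kk≤s+n s²+s≤n = *-cancelˡ-≤ (6 * E) {{m*n≢0 6 E}} (begin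
  6 * E * (E * (kk * (2 + 6 * E) + (kk + (6 * E + 6 * E))))
    ≡⟨ expand E kk ⟩
  E * (6 * E * kk * (3 + 6 * E) + 2 * (6 * E * (6 * E)))
    ≤⟨ *-monoʳ-≤ E (+-monoˡ-≤ (2 * (6 * E * (6 * E))) (*-monoˡ-≤ (3 + 6 * E) s*kk≤s+n)) ⟩
  E * ((6 * E + n) * (3 + 6 * E) + 2 * (6 * E * (6 * E)))
    ≡⟨ regroup E n ⟩
  E * (6 * E * n + 3 * n + 3 * (6 * E * (6 * E) + 6 * E))
    ≤⟨ *-monoʳ-≤ E (+-monoʳ-≤ (6 * E * n + 3 * n) (*-monoʳ-≤ 3 s²+s≤n)) ⟩
  E * (6 * E * n + 3 * n + 3 * n)
    ≡⟨ collect E n ⟩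
  6 * E * (suc E * n) ∎)
  where
    open ≤-Reasoning
    expand : ∀ E kk → 6 * E * (E * (kk * (2 + 6 * E) + (kk + (6 * E + 6 * E))))
                      ≡ E * (6 * E * kk * (3 + 6 * E) + 2 * (6 * E * (6 * E)))
    expand = solve-∀
    regroup : ∀ E n → E * ((6 * E + n) * (3 + 6 * E) + 2 * (6 * E * (6 * E)))
                      ≡ E * (6 * E * n + 3 * n + 3 * (6 * E * (6 * E) + 6 * E))
    regroup = solve-∀
    collect : ∀ E n → E * (6 * E * n + 3 * n + 3 * n) ≡ 6 * E * (suc E * n)
    collect = solve-∀

triples-cost-≤ : ∀ E n c₃ r q → (E + E) * c₃ ≤ suc (E + E) * n → r ≤ 2 → 12 * E ≤ r + q * 3 →
            3 * E * (r * n + q * c₃) ≤ suc E * n * (r + q * 3)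
triples-cost-≤ E n c₃ r q c₃-bound r≤2 12E≤m = *-cancelˡ-≤ 2 (begin
  2 * (3 * E * (r * n + q * c₃))
    ≡⟨ expand E n c₃ r q ⟩
  n * (6 * E * r) + 3 * q * ((E + E) * c₃)
    ≤⟨ +-mono-≤ (*-monoʳ-≤ n 6Er≤m) (*-monoʳ-≤ (3 * q) c₃-bound) ⟩
  n * (r + q * 3) + 3 * q * (suc (E + E) * n)
    ≤⟨ m≤n+m _ (suc (E + E) * r * n) ⟩
  suc (E + E) * r * n + (n * (r + q * 3) + 3 * q * (suc (E + E) * n))
    ≡⟨ collect E n r q ⟩
  2 * (suc E * n * (r + q * 3)) ∎)
  where
    open ≤-Reasoning
    6Er≤m : 6 * E * r ≤ r + q * 3
    6Er≤m = begin
      6 * E * r     ≤⟨ *-monoʳ-≤ (6 * E) r≤2 ⟩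
      6 * E * 2     ≡⟨ *-comm (6 * E) 2 ⟩
      2 * (6 * E)   ≡⟨ *-assoc 2 6 E ⟨
      12 * E        ≤⟨ 12E≤m ⟩
      r + q * 3     ∎
    expand : ∀ E n c₃ r q → 2 * (3 * E * (r * n + q * c₃)) ≡ n * (6 * E * r) + 3 * q * ((E + E) * c₃)
    expand = solve-∀
    collect : ∀ E n r q → suc (E + E) * r * n + (n * (r + q * 3) + 3 * q * (suc (E + E) * n))
                          ≡ 2 * (suc E * n * (r + q * 3))
    collect = solve-∀

-- Triples at (1 + 1/2E) n/3 bits per copy leave a slack of n/6E per copy, which pays for the
-- at most two leftover copies of n bits each once m ≥ 12E.
ccLE-⊗^-bound : ∀ {Q} E n {c₃} → ccLE Q n → ccLE (Q ⊗^ 3) c₃ → (E + E) * c₃ ≤ suc (E + E) * n →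
                ∀ m → 12 * E ≤ m → Σ ℕ λ c → ccLE (Q ⊗^ m) c × (3 * E * c ≤ suc E * n * m)
ccLE-⊗^-bound E n {c₃} cc₁ cc₃ c₃-bound m 12E≤m =
  m % 3 * n + m / 3 * c₃ , ccLE-⊗^-triples cc₁ cc₃ m ,
  subst (λ t → 3 * E * (m % 3 * n + m / 3 * c₃) ≤ suc E * n * t) (sym m≡r+q*3)
        (triples-cost-≤ E n c₃ (m % 3) (m / 3) c₃-bound (s≤s⁻¹ (m%n<n m 3)) (subst (12 * E ≤_) m≡r+q*3 12E≤m))
  where
    m≡r+q*3 : m ≡ m % 3 + m / 3 * 3
    m≡r+q*3 = m≡m%n+[m/n]*n m 3

-- With blocks of s = 6(k+1) bits the code has at most n + 3n/s + 3s + 3 ≤ n + 6n/s bits once n ≥ s² + s.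
ccLE-triple-bound : ∀ k n → 6 * suc k * (6 * suc k) + 6 * suc k ≤ n →
  ∀ (I J K : Alphabet n → Alphabet n → Alphabet n → Bool) →
  IsNOFPermutation I → IsNOFPermutation J → IsNOFPermutation K →
  Σ ℕ λ c → ccLE (triple I J K) c × (suc k * c ≤ suc (suc k) * n)
ccLE-triple-bound k n s²+s≤n I J K permI permJ permK =
  codeLength , ccLE-triple codeLength code (code-cornerInjective (n≤s*[1+n/s] n s)) permI permJ permK ,
  codeLength-≤ (suc k) n (suc (n / s)) (s*[1+n/s]≤s+n n s) s²+s≤n
  where
    s : ℕ
    s = 6 * suc k
    open BlockCode s (suc (n / s))

mainTheorem6 :
    -- cc(I ⊗ J ⊗ K) ≤ (1 + ε) n  for ε = 1/(k+1), all n ≥ N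
    (∀ (k : ℕ) → Σ ℕ λ N → ∀ (n : ℕ) → N ≤ n →
       ∀ (I J K : Alphabet n → Alphabet n → Alphabet n → Bool) →
       IsNOFPermutation I → IsNOFPermutation J → IsNOFPermutation K →
       Σ ℕ λ c → ccLE (triple I J K) c × (suc k * c ≤ suc (suc k) * n))
    ×
    -- acc(I) ≤ (1 + ε) n / 3 : eventually cc(Ĩ^⊗m) / m ≤ (1 + ε) n / 3
    (∀ (k : ℕ) → Σ ℕ λ N → ∀ (n : ℕ) → N ≤ n →
       ∀ (I : Alphabet n → Alphabet n → Alphabet n → Bool) →
       IsNOFPermutation I →
       Σ ℕ λ M → ∀ (m : ℕ) → M ≤ m →
       Σ ℕ λ c → ccLE (NOFProblem I ⊗^ m) c
                 × (3 * suc k * c ≤ suc (suc k) * n * m))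
mainTheorem6 =
  (λ k → threshold k , ccLE-triple-bound k) ,
  (λ k → threshold (k + suc k) , λ n N≤n I perm →
    let (c₃ , cc₃ , c₃-bound) = ccLE-triple-bound (k + suc k) n N≤n I I I perm perm perm
    in 12 * suc k , ccLE-⊗^-bound (suc k) n (ccLE-NOFProblem perm) (ccLE-≼ ⊗^-3 cc₃) c₃-bound)
  where
    threshold : ℕ → ℕ
    threshold k = 6 * suc k * (6 * suc k) + 6 * suc k
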